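{- Let a diagram carry a semi-proper labeling of shape $\alpha$, let $r<s$ be labels, and suppose $s$ abuts $r$ in column $c$. Then the exchange labeling $\mathcal{L}^{c}_{r,s}$ is again a semi-proper labeling (of some shape).
   Context: A diagram is a finite set of cells $(c,r)\in\mathbb{Z}_{>0}^2$ (column $c$, row $r$, rows numbered upward). A labeling assigns a positive integer to each cell. It is semi-proper of shape $\alpha\in\mathbb{Z}_{\ge0}^m$ if (i) for each column $c$ the entries in column $c$ are distinct and form exactly $\{r:\alpha_r\ge c\}$; (ii) every entry in row $r$ is at least $r$; (iii) the cells with any given entry weakly descend from left to right. For labels $r<s$ in a semi-proper labeling, $s$ touches $r$ at column $c$ if there is an $s$ in column $c+1$ and it lies weakly below the $r$ in column $c$; in that case $s$ crosses $r$ at column $c$ if there is an $r$ in column $c+1$ above that $s$, and otherwise $s$ abuts $r$ at column $c$. If $s$ abuts $r$ in column $c$, the exchange labeling $\mathcal{L}^{c}_{r,s}$ is obtained by simultaneously changing every label $r$ to $s$ and every label $s$ to $r$ in columns $c+1,\ldots,d$, where $d$ is the leftmost column to the right of $c$ at which $s$ touches $r$, if it exists, and otherwise $d=\alpha_s$. -}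

module Defs where

open import Data.Nat using (ℕ; zero; suc; _≤_; _<_; _≟_; _≤?_)
open import Data.Bool using (Bool; true; false; if_then_else_; _∧_)
open import Data.List using (List; []; _∷_)
open import Data.List.Membership.Propositional using (_∈_)
open import Data.List.Relation.Unary.All using (All)
open import Data.Product using (_×_; _,_; ∃; ∃-syntax)
open import Data.Sum using (_⊎_)
open import Relation.Nullary using (¬_; does)
open import Relation.Binary.PropositionalEquality using (_≡_)
open import Function.Bundles using (_⇔_)

-- A cell is (column , row).  A diagram is a finite set of cells, given as a
-- list (membership is what matters); all coordinates must be positive.
Cell : Set
Cell = ℕ × ℕ

Diagram : Set
Diagram = List Cell

PositiveCell : Cell → Set
PositiveCell (c , r) = 1 ≤ c × 1 ≤ r

IsDiagram : Diagram → Set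
IsDiagram D = All PositiveCell D

-- A labeling: column → row → label (only values on cells of D matter).
Labeling : Set
Labeling = ℕ → ℕ → ℕ

-- A weak composition α = (α_1,…,α_m) as a list; α_r = 0 for r = 0 or r > m.
Shape : Set
Shape = List ℕ

_at_ : Shape → ℕ → ℕ
α at zero = 0
[] at suc r = 0
(a ∷ α) at suc zero = a
(a ∷ α) at suc (suc r) = α at suc r

HasLabelAt : Diagram → Labeling → ℕ → ℕ → ℕ → Set
HasLabelAt D L x c i = (c , i) ∈ D × L c i ≡ x

record SemiProper (D : Diagram) (L : Labeling) (α : Shape) : Set where
  field
    colDistinct : ∀ c i j → (c , i) ∈ D → (c , j) ∈ D → L c i ≡ L c j → i ≡ j
    colEntries  : ∀ c → 1 ≤ c → ∀ x → (∃[ i ] HasLabelAt D L x c i) ⇔ (c ≤ α at x)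
    rowBound    : ∀ c i → (c , i) ∈ D → i ≤ L c i
    descend     : ∀ c i c' i' → (c , i) ∈ D → (c' , i') ∈ D → L c i ≡ L c' i' →
                  c < c' → i' ≤ i

Touches : Diagram → Labeling → ℕ → ℕ → ℕ → Set
Touches D L r s c = ∃[ i ] ∃[ j ] (HasLabelAt D L r c i × HasLabelAt D L s (suc c) j × j ≤ i)

Crosses : Diagram → Labeling → ℕ → ℕ → ℕ → Set
Crosses D L r s c = ∃[ i ] ∃[ j ] ∃[ k ]
  (HasLabelAt D L r c i × HasLabelAt D L s (suc c) j × j ≤ i ×
   HasLabelAt D L r (suc c) k × j < k)

Abuts : Diagram → Labeling → ℕ → ℕ → ℕ → Set
Abuts D L r s c = Touches D L r s c × ¬ Crosses D L r s c

ExchangeEnd : Diagram → Labeling → Shape → ℕ → ℕ → ℕ → ℕ → Set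
ExchangeEnd D L α r s c d =
  (c < d × Touches D L r s d × (∀ e → c < e → e < d → ¬ Touches D L r s e))
  ⊎ ((∀ e → c < e → ¬ Touches D L r s e) × d ≡ α at s)

swapLabel : ℕ → ℕ → ℕ → ℕ
swapLabel r s x = if does (x ≟ r) then s else (if does (x ≟ s) then r else x)

exchange : Labeling → ℕ → ℕ → ℕ → ℕ → Labeling
exchange L r s lo hi c i =
  if does (lo ≤? c) ∧ does (c ≤? hi) then swapLabel r s (L c i) else L c i

-- On the columns c+1, …, d the exchange acts by the transposition (r s) of
-- labels, so columns stay duplicate-free, and the row condition survives
-- because an s turned into r lies weakly below the s in column c+1, hence
-- weakly below the r in column c.  Descent can only fail for two cells on
-- opposite sides of a boundary of the exchanged block.  At the left boundary
-- this is excluded because s abuts r at c.  At the right boundary an r in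
-- column d+1 lies weakly below the s in column d (s touches r at no column
-- strictly between c and d), and an s beyond column d lies weakly below every
-- r up to column d (s touches r at d, or there is no s beyond d = α_s).  The
-- shape stays α when s touches r at d; otherwise the parts α_r, α_s are
-- replaced by their maximum and minimum.
{-# OPTIONS --safe #-}
module Submission where

open import Defs
open import Data.Nat using (ℕ; zero; suc; _<_; _≤_; _≟_; _≤?_; z≤n; s≤s; _⊔_; _⊓_)
open import Data.Nat.Properties
open import Data.Bool using (if_then_else_; _∧_)
open import Data.Bool.Properties using (∧-zeroʳ)
open import Data.List using ([]; _∷_)
open import Data.List.Membership.Propositional using (_∈_)
open import Data.List.Relation.Unary.All using (lookup)
open import Data.Product using (∃-syntax; _,_; proj₁; proj₂)
open import Data.Sum using (inj₁; inj₂)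
open import Data.Empty using (⊥-elim)
open import Relation.Nullary using (¬_; does; yes; no)
open import Relation.Nullary.Decidable using (dec-true; dec-false)
open import Relation.Binary.PropositionalEquality
open import Function using (_∘_)
open import Function.Bundles using (_⇔_; mk⇔; Equivalence)
import Function.Properties.Equivalence as ⇔
open import Algebra.Definitions {A = ℕ} _≡_ using (Involutive; SelfInverse)
open import Algebra.Consequences.Propositional {A = ℕ} using (selfInverse⇒injective)

⇔-both : ∀ {a b} {A : Set a} {B : Set b} → A → B → A ⇔ B
⇔-both a b = mk⇔ (λ _ → b) (λ _ → a)

⇔-neither : ∀ {a b} {A : Set a} {B : Set b} → ¬ A → ¬ B → A ⇔ B
⇔-neither ¬a ¬b = mk⇔ (⊥-elim ∘ ¬a) (⊥-elim ∘ ¬b)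

≤-respʳ-⇔ : ∀ {e a b} → a ≡ b → (e ≤ a) ⇔ (e ≤ b)
≤-respʳ-⇔ refl = ⇔.refl

involutive⇒selfInverse : ∀ {f : ℕ → ℕ} → Involutive f → SelfInverse f
involutive⇒selfInverse f-involutive refl = f-involutive _

module _ (r s : ℕ) where

  swapLabel-left : swapLabel r s r ≡ s
  swapLabel-left =
    cong (λ b → if b then s else (if does (r ≟ s) then r else r)) (dec-true (r ≟ r) refl)

  swapLabel-other : ∀ {x} → x ≢ r → x ≢ s → swapLabel r s x ≡ x
  swapLabel-other {x} x≢r x≢s =
    trans (cong (λ b → if b then s else (if does (x ≟ s) then r else x))
                (dec-false (x ≟ r) x≢r))
          (cong (λ b → if b then r else x) (dec-false (x ≟ s) x≢s))

  swapLabel-right : swapLabel r s s ≡ r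
  swapLabel-right with s ≟ r
  ... | yes refl = swapLabel-left
  ... | no s≢r = trans (cong (λ b → if b then s else (if does (s ≟ s) then r else s))
                             (dec-false (s ≟ r) s≢r))
                       (cong (λ b → if b then r else s) (dec-true (s ≟ s) refl))

  swapLabel-involutive : Involutive (swapLabel r s)
  swapLabel-involutive x with x ≟ r | x ≟ s
  ... | yes refl | _ = trans (cong (swapLabel r s) swapLabel-left) swapLabel-right
  ... | no _ | yes refl = trans (cong (swapLabel r s) swapLabel-right) swapLabel-left
  ... | no x≢r | no x≢s =
    trans (cong (swapLabel r s) (swapLabel-other x≢r x≢s)) (swapLabel-other x≢r x≢s)

  swapLabel-≤at : ∀ {α e x} → e ≤ α at r → e ≤ α at s →
                  (e ≤ α at swapLabel r s x) ⇔ (e ≤ α at x)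
  swapLabel-≤at {α} {e} {x} e≤αr e≤αs with x ≟ r | x ≟ s
  ... | yes refl | _ = ⇔.trans (≤-respʳ-⇔ (cong (α at_) swapLabel-left)) (⇔-both e≤αs e≤αr)
  ... | no _ | yes refl = ⇔.trans (≤-respʳ-⇔ (cong (α at_) swapLabel-right)) (⇔-both e≤αr e≤αs)
  ... | no x≢r | no x≢s = ≤-respʳ-⇔ (cong (α at_) (swapLabel-other x≢r x≢s))

-- exchange L r s lo hi e i reduces to exchangeLabel r s lo hi e (L e i).
exchangeLabel : ℕ → ℕ → ℕ → ℕ → ℕ → ℕ → ℕ
exchangeLabel r s lo hi e x =
  if does (lo ≤? e) ∧ does (e ≤? hi) then swapLabel r s x else x

data Region (c d e : ℕ) : Set where
  left   : e ≤ c → Region c d e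
  middle : c < e → e ≤ d → Region c d e
  right  : d < e → Region c d e

region : ∀ c d e → Region c d e
region c d e with e ≤? c
... | yes e≤c = left e≤c
... | no e≰c with e ≤? d
...   | yes e≤d = middle (≰⇒> e≰c) e≤d
...   | no e≰d = right (≰⇒> e≰d)

module _ {r s c d e x : ℕ} where

  exchangeLabel-left : e ≤ c → exchangeLabel r s (suc c) d e x ≡ x
  exchangeLabel-left e≤c =
    cong (λ b → if b ∧ does (e ≤? d) then swapLabel r s x else x)
         (dec-false (suc c ≤? e) (≤⇒≯ e≤c))

  exchangeLabel-middle : c < e → e ≤ d → exchangeLabel r s (suc c) d e x ≡ swapLabel r s x
  exchangeLabel-middle c<e e≤d =
    cong (λ b → if b then swapLabel r s x else x)
         (cong₂ _∧_ (dec-true (suc c ≤? e) c<e) (dec-true (e ≤? d) e≤d))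

  exchangeLabel-right : d < e → exchangeLabel r s (suc c) d e x ≡ x
  exchangeLabel-right d<e =
    cong (λ b → if b then swapLabel r s x else x)
         (trans (cong (does (suc c ≤? e) ∧_) (dec-false (e ≤? d) (<⇒≱ d<e))) (∧-zeroʳ _))

exchangeLabel-fixes : ∀ {r s c d e x} → x ≢ r → x ≢ s → exchangeLabel r s (suc c) d e x ≡ x
exchangeLabel-fixes {r} {s} {c} {d} {e} x≢r x≢s with region c d e
... | left p = exchangeLabel-left p
... | middle p q = trans (exchangeLabel-middle p q) (swapLabel-other r s x≢r x≢s)
... | right p = exchangeLabel-right p

exchangeLabel-involutive : ∀ r s c d e → Involutive (exchangeLabel r s (suc c) d e)
exchangeLabel-involutive r s c d e x with region c d e
... | left p = trans (exchangeLabel-left p) (exchangeLabel-left p)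
... | middle p q = begin
  τ (τ x)                 ≡⟨ exchangeLabel-middle p q ⟩
  swapLabel r s (τ x)     ≡⟨ cong (swapLabel r s) (exchangeLabel-middle p q) ⟩
  swapLabel r s (swapLabel r s x) ≡⟨ swapLabel-involutive r s x ⟩
  x                       ∎
  where
  open ≡-Reasoning
  τ : ℕ → ℕ
  τ = exchangeLabel r s (suc c) d e
... | right p = trans (exchangeLabel-right p) (exchangeLabel-right p)

exchangeLabel-≤at : ∀ {α r s c d} → d ≤ α at r → d ≤ α at s →
                    ∀ e x → (e ≤ α at exchangeLabel r s (suc c) d e x) ⇔ (e ≤ α at x)
exchangeLabel-≤at {α} {r} {s} {c} {d} d≤αr d≤αs e x with region c d e
... | left p = ≤-respʳ-⇔ (cong (α at_) (exchangeLabel-left p))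
... | middle p q = ⇔.trans (≤-respʳ-⇔ (cong (α at_) (exchangeLabel-middle p q)))
                          (swapLabel-≤at r s {x = x} (≤-trans q d≤αr) (≤-trans q d≤αs))
... | right p = ≤-respʳ-⇔ (cong (α at_) (exchangeLabel-right p))

-- Index 0 is not a part (α at 0 = 0), so updating it does nothing.
_[_]≔_ : Shape → ℕ → ℕ → Shape
α [ zero ]≔ v = α
[] [ suc zero ]≔ v = v ∷ []
[] [ suc (suc k) ]≔ v = 0 ∷ ([] [ suc k ]≔ v)
(a ∷ α) [ suc zero ]≔ v = v ∷ α
(a ∷ α) [ suc (suc k) ]≔ v = a ∷ (α [ suc k ]≔ v)

at∘[]≔ : ∀ α k v → 1 ≤ k → (α [ k ]≔ v) at k ≡ v
at∘[]≔ [] (suc zero) v _ = refl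
at∘[]≔ [] (suc (suc k)) v _ = at∘[]≔ [] (suc k) v (s≤s z≤n)
at∘[]≔ (a ∷ α) (suc zero) v _ = refl
at∘[]≔ (a ∷ α) (suc (suc k)) v _ = at∘[]≔ α (suc k) v (s≤s z≤n)

at∘[]≔′ : ∀ α k v x → x ≢ k → (α [ k ]≔ v) at x ≡ α at x
at∘[]≔′ α zero v x x≢k = refl
at∘[]≔′ α (suc k) v zero x≢k = refl
at∘[]≔′ [] (suc zero) v (suc zero) x≢k = ⊥-elim (x≢k refl)
at∘[]≔′ [] (suc zero) v (suc (suc y)) x≢k = refl
at∘[]≔′ [] (suc (suc k)) v (suc zero) x≢k = refl
at∘[]≔′ [] (suc (suc k)) v (suc (suc y)) x≢k = at∘[]≔′ [] (suc k) v (suc y) (x≢k ∘ cong suc)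
at∘[]≔′ (a ∷ α) (suc zero) v (suc zero) x≢k = ⊥-elim (x≢k refl)
at∘[]≔′ (a ∷ α) (suc zero) v (suc (suc y)) x≢k = refl
at∘[]≔′ (a ∷ α) (suc (suc k)) v (suc zero) x≢k = refl
at∘[]≔′ (a ∷ α) (suc (suc k)) v (suc (suc y)) x≢k = at∘[]≔′ α (suc k) v (suc y) (x≢k ∘ cong suc)

positive-at⇒positive : ∀ α {e} x → 1 ≤ e → e ≤ α at x → 1 ≤ x
positive-at⇒positive α zero 1≤e e≤0 = ≤-trans 1≤e e≤0
positive-at⇒positive α (suc x) _ _ = s≤s z≤n

exchangedShape : Shape → ℕ → ℕ → Shape
exchangedShape α r s = (α [ r ]≔ (α at r ⊔ α at s)) [ s ]≔ (α at r ⊓ α at s)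

≤⊔<⇒≤ : ∀ {m n o} → o < m → m ≤ n ⊔ o → m ≤ n
≤⊔<⇒≤ {m} {n} {o} o<m m≤n⊔o with ≤-total n o
... | inj₁ n≤o = ⊥-elim (<⇒≱ o<m (subst (m ≤_) (m≤n⇒m⊔n≡n n≤o) m≤n⊔o))
... | inj₂ o≤n = subst (m ≤_) (m≥n⇒m⊔n≡m o≤n) m≤n⊔o

module _ {α : Shape} {r s c : ℕ} (c≤αr : c ≤ α at r) (c<αs : c < α at s) (e : ℕ) where
  private
    τ : ℕ → ℕ
    τ = exchangeLabel r s (suc c) (α at s) e
    β : Shape
    β = exchangedShape α r s

  ≤at-exchangeLabel-r : (e ≤ α at τ r) ⇔ (e ≤ α at r ⊔ α at s)
  ≤at-exchangeLabel-r with region c (α at s) e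
  ... | left p = ⇔.trans (≤-respʳ-⇔ (cong (α at_) (exchangeLabel-left p)))
                         (⇔-both e≤αr (m≤n⇒m≤n⊔o (α at s) e≤αr))
    where
    e≤αr : e ≤ α at r
    e≤αr = ≤-trans p c≤αr
  ... | middle p q =
    ⇔.trans (≤-respʳ-⇔ (cong (α at_) (trans (exchangeLabel-middle p q) (swapLabel-left r s))))
            (⇔-both q (m≤n⇒m≤o⊔n (α at r) q))
  ... | right p = ⇔.trans (≤-respʳ-⇔ (cong (α at_) (exchangeLabel-right p)))
                          (mk⇔ (m≤n⇒m≤n⊔o (α at s)) (≤⊔<⇒≤ p))

  ≤at-exchangeLabel-s : (e ≤ α at τ s) ⇔ (e ≤ α at r ⊓ α at s)
  ≤at-exchangeLabel-s with region c (α at s) e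
  ... | left p = ⇔.trans (≤-respʳ-⇔ (cong (α at_) (exchangeLabel-left p)))
                         (⇔-both e≤αs (⊓-glb (≤-trans p c≤αr) e≤αs))
    where
    e≤αs : e ≤ α at s
    e≤αs = ≤-trans p (<⇒≤ c<αs)
  ... | middle p q =
    ⇔.trans (≤-respʳ-⇔ (cong (α at_) (trans (exchangeLabel-middle p q) (swapLabel-right r s))))
            (mk⇔ (λ e≤αr → ⊓-glb e≤αr q) (m≤n⊓o⇒m≤n (α at r) (α at s)))
  ... | right p = ⇔.trans (≤-respʳ-⇔ (cong (α at_) (exchangeLabel-right p)))
                          (⇔-neither (<⇒≱ p) (<⇒≱ p ∘ m≤n⊓o⇒m≤o (α at r) (α at s)))

  exchangeLabel-≤at-exchangedShape : 1 ≤ r → r < s →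
    ∀ x → (e ≤ α at exchangeLabel r s (suc c) (α at s) e x) ⇔ (e ≤ exchangedShape α r s at x)
  exchangeLabel-≤at-exchangedShape 1≤r r<s x with x ≟ r | x ≟ s
  ... | yes refl | _ = ⇔.trans ≤at-exchangeLabel-r (≤-respʳ-⇔ (sym β-at-r))
    where
    β-at-r : β at r ≡ α at r ⊔ α at s
    β-at-r = trans (at∘[]≔′ _ s _ r (<⇒≢ r<s)) (at∘[]≔ α r _ 1≤r)
  ... | no _ | yes refl = ⇔.trans ≤at-exchangeLabel-s (≤-respʳ-⇔ (sym β-at-s))
    where
    β-at-s : β at s ≡ α at r ⊓ α at s
    β-at-s = at∘[]≔ _ s _ (≤-trans 1≤r (<⇒≤ r<s))
  ... | no x≢r | no x≢s =
    ⇔.trans (≤-respʳ-⇔ (cong (α at_) (exchangeLabel-fixes {c = c} {e = e} x≢r x≢s)))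
            (≤-respʳ-⇔ (sym β-at-x))
    where
    β-at-x : β at x ≡ α at x
    β-at-x = trans (at∘[]≔′ _ s _ x x≢s) (at∘[]≔′ α r _ x x≢r)

module SemiProperProperties {D : Diagram} (isD : IsDiagram D)
                            {L : Labeling} {α : Shape} (sp : SemiProper D L α) where
  open SemiProper sp

  column-positive : ∀ {e i} → (e , i) ∈ D → 1 ≤ e
  column-positive m = proj₁ (lookup isD m)

  occurs⇒≤shape : ∀ {x e i} → HasLabelAt D L x e i → e ≤ α at x
  occurs⇒≤shape {x} {e} {i} occ =
    Equivalence.to (colEntries e (column-positive (proj₁ occ)) x) (i , occ)

  ≤shape⇒occurs : ∀ {x e} → 1 ≤ e → e ≤ α at x → ∃[ i ] HasLabelAt D L x e i
  ≤shape⇒occurs {x} {e} 1≤e = Equivalence.from (colEntries e 1≤e x)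

  descend-≤ : ∀ {x e i e' i'} → HasLabelAt D L x e i → HasLabelAt D L x e' i' → e ≤ e' → i' ≤ i
  descend-≤ {e = e} {i} {e'} {i'} (m , Lei≡x) (m' , Le'i'≡x) e≤e' with m≤n⇒m<n∨m≡n e≤e'
  ... | inj₁ e<e' = descend e i e' i' m m' (trans Lei≡x (sym Le'i'≡x)) e<e'
  ... | inj₂ refl = ≤-reflexive (sym (colDistinct e i i' m m' (trans Lei≡x (sym Le'i'≡x))))

module Relabel {D : Diagram} {L : Labeling} {α : Shape} (sp : SemiProper D L α)
               (τ : ℕ → ℕ → ℕ) (τ-involutive : ∀ e → Involutive (τ e)) where
  open SemiProper sp

  relabelled : Labeling
  relabelled e i = τ e (L e i)

  τ-selfInverse : ∀ {e} → SelfInverse (τ e)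
  τ-selfInverse {e} = involutive⇒selfInverse (τ-involutive e)

  relabelled-colDistinct : ∀ e i j → (e , i) ∈ D → (e , j) ∈ D →
                           relabelled e i ≡ relabelled e j → i ≡ j
  relabelled-colDistinct e i j m m' =
    colDistinct e i j m m' ∘ selfInverse⇒injective τ-selfInverse

  relabelled-occurs : ∀ {x e} → (∃[ i ] HasLabelAt D relabelled x e i) ⇔
                                (∃[ i ] HasLabelAt D L (τ e x) e i)
  relabelled-occurs {x} {e} = mk⇔
    (λ { (i , m , eq) → i , m , sym (τ-selfInverse eq) })
    (λ { (i , m , eq) → i , m , τ-selfInverse (sym eq) })

  relabelled-colEntries : (β : Shape) → (∀ e x → (e ≤ α at τ e x) ⇔ (e ≤ β at x)) →
                          ∀ e → 1 ≤ e → ∀ x → (∃[ i ] HasLabelAt D relabelled x e i) ⇔ (e ≤ β at x)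
  relabelled-colEntries β shape e 1≤e x =
    ⇔.trans relabelled-occurs (⇔.trans (colEntries e 1≤e (τ e x)) (shape e x))

module Exchange {D : Diagram} (isD : IsDiagram D) {L : Labeling} {α : Shape}
  (sp : SemiProper D L α) {r s c : ℕ} (r<s : r < s)
  {i₀ j₀ : ℕ} (r-at-c : HasLabelAt D L r c i₀) (s-at-c+1 : HasLabelAt D L s (suc c) j₀)
  (j₀≤i₀ : j₀ ≤ i₀) (no-cross : ¬ Crosses D L r s c)
  {d : ℕ} (c<d : c < d) (d≤αs : d ≤ α at s)
  (no-touch : ∀ e → c < e → e < d → ¬ Touches D L r s e)
  (s-after-d-below-r : ∀ {e i e' i'} → e ≤ d → d < e' →
                       HasLabelAt D L r e i → HasLabelAt D L s e' i' → i' ≤ i)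
  where
  open SemiProper sp
  open SemiProperProperties isD sp

  σ : ℕ → ℕ
  σ = swapLabel r s

  σ-r : ∀ {x} → x ≡ r → σ x ≡ s
  σ-r refl = swapLabel-left r s

  σ-s : ∀ {x} → x ≡ s → σ x ≡ r
  σ-s refl = swapLabel-right r s

  σ-selfInverse : SelfInverse σ
  σ-selfInverse = involutive⇒selfInverse (swapLabel-involutive r s)

  τ : ℕ → ℕ → ℕ
  τ = exchangeLabel r s (suc c) d

  open Relabel sp τ (exchangeLabel-involutive r s c d)

  r-at-c+1-below-s-at-c+1 : ∀ {k} → HasLabelAt D L r (suc c) k → k ≤ j₀
  r-at-c+1-below-s-at-c+1 {k} r-at =
    ≮⇒≥ (λ j₀<k → no-cross (i₀ , j₀ , k , r-at-c , s-at-c+1 , j₀≤i₀ , r-at , j₀<k))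

  s-after-c-below-r : ∀ {e i e' i'} → e ≤ c → c < e' →
                      HasLabelAt D L r e i → HasLabelAt D L s e' i' → i' ≤ i
  s-after-c-below-r e≤c c<e' r-at s-at =
    ≤-trans (descend-≤ s-at-c+1 s-at c<e') (≤-trans j₀≤i₀ (descend-≤ r-at r-at-c e≤c))

  r-after-c-below-s : ∀ {e i e' i'} → e ≤ suc c → c < e' →
                      HasLabelAt D L s e i → HasLabelAt D L r e' i' → i' ≤ i
  r-after-c-below-s e≤c+1 c<e' s-at r-at =
    let (k , r-at-c+1) = ≤shape⇒occurs (s≤s z≤n) (≤-trans c<e' (occurs⇒≤shape r-at))
    in ≤-trans (descend-≤ r-at-c+1 r-at c<e')
               (≤-trans (r-at-c+1-below-s-at-c+1 r-at-c+1) (descend-≤ s-at s-at-c+1 e≤c+1))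

  -- For e > c+1, s does not touch r at e−1: the r in column e−1 lies strictly
  -- below the s in column e, and the r in column e+1 weakly below that r.
  r-next-below-s : ∀ {e k a} → c < e → e ≤ d →
                   HasLabelAt D L s e a → HasLabelAt D L r (suc e) k → k ≤ a
  r-next-below-s {suc e} {k} {a} c<1+e 1+e≤d s-at r-at with m≤n⇒m<n∨m≡n (≤-pred c<1+e)
  ... | inj₂ refl = r-after-c-below-s ≤-refl (n≤1+n _) s-at r-at
  ... | inj₁ c<e =
    let (p , r-at-e) = ≤shape⇒occurs (≤-trans (s≤s z≤n) c<e)
                                      (≤-trans (n≤1+n _) (≤-trans (n≤1+n _) (occurs⇒≤shape r-at)))
        p<a : p < a
        p<a = ≰⇒> (λ a≤p → no-touch e c<e 1+e≤d (p , a , r-at-e , s-at , a≤p))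
    in ≤-trans (descend-≤ r-at-e r-at (≤-trans (n≤1+n e) (n≤1+n _))) (<⇒≤ p<a)

  r-after-d-below-s : ∀ {e i e' i'} → c < e → e ≤ d → d < e' →
                      HasLabelAt D L s e i → HasLabelAt D L r e' i' → i' ≤ i
  r-after-d-below-s c<e e≤d d<e' s-at r-at =
    let (k , r-at-d+1) = ≤shape⇒occurs (s≤s z≤n) (≤-trans d<e' (occurs⇒≤shape r-at))
        (a , s-at-d) = ≤shape⇒occurs (≤-trans (s≤s z≤n) c<d) d≤αs
    in ≤-trans (descend-≤ r-at-d+1 r-at d<e')
               (≤-trans (r-next-below-s c<d ≤-refl s-at-d r-at-d+1) (descend-≤ s-at s-at-d e≤d))

  swapped-descend : ∀ {e i e' i'} → (e , i) ∈ D → (e' , i') ∈ D → e < e' →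
                    (L e i ≡ r → L e' i' ≡ s → i' ≤ i) → (L e i ≡ s → L e' i' ≡ r → i' ≤ i) →
                    L e i ≡ σ (L e' i') → i' ≤ i
  swapped-descend {e} {i} {e'} {i'} m m' e<e' r-s s-r eq with L e' i' ≟ r | L e' i' ≟ s
  ... | yes L≡r | _ = s-r (trans eq (σ-r L≡r)) L≡r
  ... | no _ | yes L≡s = r-s (trans eq (σ-s L≡s)) L≡s
  ... | no L≢r | no L≢s = descend e i e' i' m m' (trans eq (swapLabel-other r s L≢r L≢s)) e<e'

  relabelled-descend : ∀ e i e' i' → (e , i) ∈ D → (e' , i') ∈ D →
                       relabelled e i ≡ relabelled e' i' → e < e' → i' ≤ i
  relabelled-descend e i e' i' m m' eq e<e' with region c d e | region c d e'
  ... | left p | left p' =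
    descend e i e' i' m m' (subst₂ _≡_ (exchangeLabel-left p) (exchangeLabel-left p') eq) e<e'
  ... | left p | middle p' q' =
    swapped-descend m m' e<e'
      (λ r-at s-at → s-after-c-below-r p p' (m , r-at) (m' , s-at))
      (λ s-at r-at → r-after-c-below-s (m≤n⇒m≤1+n p) p' (m , s-at) (m' , r-at))
      (subst₂ _≡_ (exchangeLabel-left p) (exchangeLabel-middle p' q') eq)
  ... | left p | right p' =
    descend e i e' i' m m' (subst₂ _≡_ (exchangeLabel-left p) (exchangeLabel-right p') eq) e<e'
  ... | middle p q | left p' = ⊥-elim (<⇒≱ (<-trans p e<e') p')
  ... | middle p q | middle p' q' =
    descend e i e' i' m m'
      (selfInverse⇒injective σ-selfInverse
        (subst₂ _≡_ (exchangeLabel-middle p q) (exchangeLabel-middle p' q') eq)) e<e'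
  ... | middle p q | right p' =
    swapped-descend m m' e<e'
      (λ r-at s-at → s-after-d-below-r q p' (m , r-at) (m' , s-at))
      (λ s-at r-at → r-after-d-below-s p q p' (m , s-at) (m' , r-at))
      (sym (σ-selfInverse
              (subst₂ _≡_ (exchangeLabel-middle p q) (exchangeLabel-right p') eq)))
  ... | right p | left p' = ⊥-elim (<⇒≱ (<-trans (<-trans c<d p) e<e') p')
  ... | right p | middle p' q' = ⊥-elim (<⇒≱ (<-trans p e<e') q')
  ... | right p | right p' =
    descend e i e' i' m m' (subst₂ _≡_ (exchangeLabel-right p) (exchangeLabel-right p') eq) e<e'

  row≤σ : ∀ {e i} → c < e → (e , i) ∈ D → i ≤ σ (L e i)
  row≤σ {e} {i} c<e m with L e i ≟ r | L e i ≟ s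
  ... | yes L≡r | _ = ≤-trans (subst (i ≤_) L≡r (rowBound e i m))
                              (≤-trans (<⇒≤ r<s) (≤-reflexive (sym (σ-r L≡r))))
  ... | no _ | yes L≡s = ≤-trans (s-after-c-below-r ≤-refl c<e r-at-c (m , L≡s))
                                 (≤-trans i₀≤r (≤-reflexive (sym (σ-s L≡s))))
    where
    i₀≤r : i₀ ≤ r
    i₀≤r = subst (i₀ ≤_) (proj₂ r-at-c) (rowBound c i₀ (proj₁ r-at-c))
  ... | no L≢r | no L≢s = subst (i ≤_) (sym (swapLabel-other r s L≢r L≢s)) (rowBound e i m)

  relabelled-rowBound : ∀ e i → (e , i) ∈ D → i ≤ relabelled e i
  relabelled-rowBound e i m with region c d e
  ... | left p = subst (i ≤_) (sym (exchangeLabel-left p)) (rowBound e i m)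
  ... | middle p q = subst (i ≤_) (sym (exchangeLabel-middle p q)) (row≤σ p m)
  ... | right p = subst (i ≤_) (sym (exchangeLabel-right p)) (rowBound e i m)

  exchange-semiProper : (β : Shape) → (∀ e x → (e ≤ α at τ e x) ⇔ (e ≤ β at x)) →
                        SemiProper D relabelled β
  exchange-semiProper β shape = record
    { colDistinct = relabelled-colDistinct
    ; colEntries  = relabelled-colEntries β shape
    ; rowBound    = relabelled-rowBound
    ; descend     = relabelled-descend
    }

lemma3p3 : (D : Diagram) → IsDiagram D → (L : Labeling) → (α : Shape) →
           SemiProper D L α → (r s c : ℕ) → r < s → Abuts D L r s c →
           (d : ℕ) → ExchangeEnd D L α r s c d →
           ∃[ β ] SemiProper D (exchange L r s (suc c) d) β
lemma3p3 D isD L α sp r s c r<s ((i₀ , j₀ , r-at-c , s-at-c+1 , j₀≤i₀) , no-cross) d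
         (inj₁ (c<d , (p , q , r-at-d , s-at-d+1 , q≤p) , no-touch)) =
  α , Exchange.exchange-semiProper isD sp r<s r-at-c s-at-c+1 j₀≤i₀ no-cross c<d d≤αs no-touch
        s-after-d-below-r α (exchangeLabel-≤at (occurs⇒≤shape r-at-d) d≤αs)
  where
  open SemiProperProperties isD sp
  d≤αs : d ≤ α at s
  d≤αs = ≤-trans (n≤1+n d) (occurs⇒≤shape s-at-d+1)
  s-after-d-below-r : ∀ {e i e' i'} → e ≤ d → d < e' →
                      HasLabelAt D L r e i → HasLabelAt D L s e' i' → i' ≤ i
  s-after-d-below-r e≤d d<e' r-at s-at =
    ≤-trans (descend-≤ s-at-d+1 s-at d<e') (≤-trans q≤p (descend-≤ r-at r-at-d e≤d))
lemma3p3 D isD L α sp r s c r<s ((i₀ , j₀ , r-at-c , s-at-c+1 , j₀≤i₀) , no-cross) _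
         (inj₂ (no-touch , refl)) =
  exchangedShape α r s ,
  Exchange.exchange-semiProper isD sp r<s r-at-c s-at-c+1 j₀≤i₀ no-cross c<αs ≤-refl
    (λ e c<e _ → no-touch e c<e)
    (λ _ αs<e' _ s-at → ⊥-elim (<⇒≱ αs<e' (occurs⇒≤shape s-at)))
    (exchangedShape α r s)
    (λ e → exchangeLabel-≤at-exchangedShape c≤αr c<αs e 1≤r r<s)
  where
  open SemiProperProperties isD sp
  c≤αr : c ≤ α at r
  c≤αr = occurs⇒≤shape r-at-c
  c<αs : c < α at s
  c<αs = occurs⇒≤shape s-at-c+1
  1≤r : 1 ≤ r
  1≤r = positive-at⇒positive α r (column-positive (proj₁ r-at-c)) c≤αr
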